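{- Let $e$ be an even positive integer and $q=2^e$. Fix $\beta\in\mathbb{F}_{q^2}\setminus\mathbb{F}_q$, put $\bar\beta=\beta^q$ and $b=\beta+\bar\beta\in\mathbb{F}_q^*$. Fix $\lambda\in\mathbb{F}_q$ with $\operatorname{Tr}_q(\lambda)=1$, and let $\theta\in\mathbb{F}_{q^2}\setminus\mathbb{F}_q$ be a root of $X^2+X+\lambda+1$ (which is irreducible over $\mathbb{F}_q$, so $\theta^q=\theta+1$); let $c\in\mathbb{F}_q$ be the unique element with $\beta=b(c+\theta)$. Let $\alpha\in\mathbb{F}_q^*$, and for $z\in\mu_{q+1}$ set $P_\alpha(z)=\alpha(z^9+z^{ -9})$ and $Q_\beta(z)=\beta z^3+\bar\beta z^{ -3}+(\beta+\bar\beta)(z+z^{ -1})$. For $x\in\mathbb{F}_q$ define $A_x=x^2+x+\lambda$ (so $A_x\neq0$ and $A_x+1\ne0$), $$z_x=\frac{x+\theta}{\sqrt{A_x+1}},\quad t_x=z_x+z_x^{ -1},\quad s_x=z_x^3+z_x^{ -3}.$$ Then: (a) the map $x\mapsto z_x$ is a bijection from $\mathbb{F}_q$ onto $\mu_{q+1}^*$; (b) $t_x=(A_x+1)^{ -1/2}$ and $s_x=A_x(A_x+1)^{ -3/2}$; in particular $s_x\neq0$ for every $x\in\mathbb{F}_q$; (c) $P_\alpha(z_x)=\alpha(s_x^3+s_x)$ and $Q_\beta(z_x)=b(c+x+1)s_x$; (d) if $\Phi(x)=A_x+A_x^{ -1}+A_x^{ -2}$, then $1+s_x^{ -2}=\P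hi(x)$.
   Context: $\mu_{q+1}=\{z\in\mathbb{F}_{q^2}^*:z^{q+1}=1\}$, $\mu_{q+1}^*=\mu_{q+1}\setminus\{1\}$; $\operatorname{Tr}_q$ is the absolute trace from $\mathbb{F}_q$ to $\mathbb{F}_2$. For $a\in\mathbb{F}_q$, $\sqrt a$ denotes the unique $a'\in\mathbb{F}_q$ with $a'^2=a$, and $a^{1/2},a^{ -1/2},a^{ -3/2}$ are understood accordingly. -}

module Defs where

open import Level using (0ℓ)
open import Algebra.Bundles using (CommutativeRing)
open import Data.Nat using (ℕ; zero; suc; _^_)
open import Data.List using (List; []; _∷_; length)
open import Data.List.Relation.Unary.Any using (Any)
open import Data.List.Relation.Unary.AllPairs using (AllPairs)
open import Data.Product using (_×_)
open import Relation.Nullary using (¬_; yes; no)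
open import Relation.Binary.Definitions using (Decidable)
open import Relation.Binary.PropositionalEquality using (_≡_)

record FiniteField (n : ℕ) : Set₁ where
  field
    cring : CommutativeRing 0ℓ 0ℓ
  open CommutativeRing cring public
  field
    _≟_      : Decidable _≈_
    1≉0      : ¬ (1# ≈ 0#)
    _⁻¹      : Carrier → Carrier
    inverseʳ : ∀ x → ¬ (x ≈ 0#) → (x * (x ⁻¹)) ≈ 1#
    elements : List Carrier
    complete : ∀ x → Any (x ≈_) elements
    distinct : AllPairs (λ a b → ¬ (a ≈ b)) elements
    size     : length elements ≡ n

module Setup (e : ℕ) (F : FiniteField ((2 ^ e) ^ 2)) where
  open FiniteField F public

  q : ℕ
  q = 2 ^ e

  infixr 8 _^ᶠ_
  _^ᶠ_ : Carrier → ℕ → Carrier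
  x ^ᶠ zero  = 1#
  x ^ᶠ suc n = x * (x ^ᶠ n)

  InFq : Carrier → Set
  InFq x = (x ^ᶠ q) ≈ x

  InMu : Carrier → Set
  InMu z = (z ^ᶠ (q Data.Nat.+ 1)) ≈ 1#

  InMu* : Carrier → Set
  InMu* z = InMu z × ¬ (z ≈ 1#)

  trAux : ℕ → Carrier → Carrier
  trAux zero    a = 0#
  trAux (suc i) a = (a ^ᶠ (2 ^ i)) + trAux i a

  Tr : Carrier → Carrier
  Tr a = trAux e a

  -- √a : the (unique) a' ∈ 𝔽_q with a'² = a, found by search through
  -- the enumeration of the field (defaults to 0 if none exists, which
  -- never happens for a ∈ 𝔽_q in characteristic 2).
  searchSqrt : Carrier → List Carrier → Carrier
  searchSqrt a [] = 0#
  searchSqrt a (y ∷ ys) with (y ^ᶠ q) ≟ y | (y * y) ≟ a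
  ... | yes _ | yes _ = y
  ... | _     | _     = searchSqrt a ys

  sqrt : Carrier → Carrier
  sqrt a = searchSqrt a elements

  conj : Carrier → Carrier
  conj x = x ^ᶠ q

  P : Carrier → Carrier → Carrier
  P α z = α * ((z ^ᶠ 9) + ((z ⁻¹) ^ᶠ 9))

  Q : Carrier → Carrier → Carrier
  Q β z = ((β * (z ^ᶠ 3)) + (conj β * ((z ⁻¹) ^ᶠ 3)))
          + ((β + conj β) * (z + (z ⁻¹)))

  A : Carrier → Carrier → Carrier
  A λ' x = ((x ^ᶠ 2) + x) + λ'

  zx : Carrier → Carrier → Carrier → Carrier
  zx λ' θ x = (x + θ) * ((sqrt (A λ' x + 1#)) ⁻¹)

  tx : Carrier → Carrier → Carrier → Carrier
  tx λ' θ x = zx λ' θ x + ((zx λ' θ x) ⁻¹)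

  sx : Carrier → Carrier → Carrier → Carrier
  sx λ' θ x = (zx λ' θ x ^ᶠ 3) + (((zx λ' θ x) ⁻¹) ^ᶠ 3)

  Φ : Carrier → Carrier → Carrier
  Φ λ' x = (A λ' x + ((A λ' x) ⁻¹)) + (((A λ' x) ⁻¹) ^ᶠ 2)

{-# OPTIONS --safe #-}
module Submission where

-- The field 𝔽_{q²} has even order, so it has characteristic 2.  Since θ^q = θ + 1,
-- w = x + θ has conjugate w + 1 and norm w (w + 1) = A_x + 1 = r², where r = √(A_x + 1) ∈ 𝔽_q.
-- Hence, with t = r⁻¹, z_x = w t and z̄ = (w + 1) t are conjugate with z_x z̄ = w (w + 1) t² = 1,
-- so z_x ∈ μ_{q+1}, t_x = z_x + z̄ = t and s_x = z_x³ + z̄³ = (w (w + 1) + 1) t³ = A_x t³;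
-- (c) and (d) are polynomial identities in w and t modulo w (w + 1) t² = 1.
-- Conversely z ∈ μ*_{q+1} is z_x for x = z / (z + z⁻¹) + θ.

open import Level using (0ℓ; _⊔_)
open import Algebra.Bundles using (CommutativeRing; RawRing)
import Data.Nat as ℕ
open import Data.Nat using (ℕ; zero; suc; NonZero; _<_)
open import Data.Nat.Divisibility using (_∣_; ∣-refl; ∣-trans; _∣0; m∣m*n; ∣m∣n⇒∣m+n; ∣m+n∣m⇒∣n; ∣1⇒≡1)
open import Data.Nat.Induction using (<-wellFounded)
import Data.Nat.Properties as ℕₚ
open import Data.Product using (_×_; _,_; Σ; proj₁; proj₂)
open import Data.Sum using (_⊎_; inj₁; inj₂; fromInj₂)
open import Function using (id; _∘_)
open import Induction.WellFounded using (Acc; acc)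
open import Relation.Binary.Bundles using (Setoid)
open import Relation.Binary.Core using (_Preserves_⟶_)
open import Relation.Binary.PropositionalEquality as ≡ using (_≡_)
open import Relation.Nullary using (¬_; yes; no; contradiction)

open import Defs

module _ {c ℓ} (S : Setoid c ℓ) where
  open Setoid S renaming (Carrier to A)
  import Data.List as List using (length)
  open import Data.List.Relation.Unary.Any as Any using (Any)
  open import Data.List.Relation.Unary.Unique.Setoid S using (Unique; []; _∷_)
  open import Data.List.Fresh using (List#; []; cons; length; fromList)
  open import Data.List.Fresh.Membership.Setoid S using (_∈_)
  open import Data.List.Fresh.Relation.Unary.Any using (here; there; _─_)
  open import Data.List.Fresh.Relation.Unary.Any.Properties using (length-remove)
  open import Data.List.Fresh.Membership.Setoid.Properties S
    using (≈-subst-∈; fresh⇒∉; distinct; ∈-remove; ∉-remove)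

  length-fromList : ∀ {xs} (u : Unique xs) → length (fromList u) ≡ List.length xs
  length-fromList []      = ≡.refl
  length-fromList (_ ∷ u) = ≡.cong suc (length-fromList u)

  ∈-fromList⁺ : ∀ {x xs} (u : Unique xs) → Any (x ≈_) xs → x ∈ fromList u
  ∈-fromList⁺ (_ ∷ u) (Any.here x≈y)   = here x≈y
  ∈-fromList⁺ (_ ∷ u) (Any.there x∈xs) = there (∈-fromList⁺ u x∈xs)

  ∈-─⁻ : ∀ {x y} {xs : List# A _≉_} (x∈xs : x ∈ xs) → y ∈ (xs ─ x∈xs) → y ∈ xs
  ∈-─⁻ (here _)     y∈xs'         = there y∈xs'
  ∈-─⁻ (there _)    (here y≈x)    = here y≈x
  ∈-─⁻ (there x∈xs) (there y∈xs') = there (∈-─⁻ x∈xs y∈xs')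

  module _ {σ : A → A} (σ-cong : σ Preserves _≈_ ⟶ _≈_) (σ-involutive : ∀ x → σ (σ x) ≈ x) where

    σ-injective : ∀ {x y} → σ x ≈ σ y → x ≈ y
    σ-injective σx≈σy = trans (sym (σ-involutive _)) (trans (σ-cong σx≈σy) (σ-involutive _))

    σ-Closed FixedPointFree : List# A _≉_ → Set (c ⊔ ℓ)
    σ-Closed xs       = ∀ {y} → y ∈ xs → σ y ∈ xs
    FixedPointFree xs = ∀ {y} → y ∈ xs → σ y ≉ y

    fixedPointFree-involution⇒2∣length : ∀ xs → σ-Closed xs → FixedPointFree xs → 2 ∣ length xs
    fixedPointFree-involution⇒2∣length xs = go xs (<-wellFounded (length xs))
      where
      go : ∀ xs → Acc _<_ (length xs) → σ-Closed xs → FixedPointFree xs → 2 ∣ length xs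
      go []               _         _      _   = 2 ∣0
      go (cons x xs x#xs) (acc rec) closed fpf with closed (here refl)
      ... | here σx≈x   = contradiction σx≈x (fpf (here refl))
      ... | there σx∈xs =
        ≡.subst (2 ∣_) (≡.cong suc (≡.sym (length-remove σx∈xs)))
          (∣m∣n⇒∣m+n ∣-refl (go ys (rec |ys|<|x∷xs|) closed′ fpf′))
        where
        ys : List# A _≉_
        ys = xs ─ σx∈xs
        |ys|<|x∷xs| : length ys < suc (length xs)
        |ys|<|x∷xs| = ℕₚ.m<n⇒m<1+n (ℕₚ.≤-reflexive (≡.sym (length-remove σx∈xs)))
        y∈ys⇒y∈xs : ∀ {y} → y ∈ ys → y ∈ xs
        y∈ys⇒y∈xs = ∈-─⁻ σx∈xs
        closed′ : σ-Closed ys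
        closed′ {y} y∈ys with closed (there (y∈ys⇒y∈xs y∈ys))
        ... | here σy≈x   = contradiction (≈-subst-∈ (σ-injective (trans σy≈x (sym (σ-involutive x)))) y∈ys)
                                          (∉-remove id id σx∈xs)
        ... | there σy∈xs = ∈-remove σx∈xs σy∈xs
                              (λ σx≈σy → distinct (y∈ys⇒y∈xs y∈ys) (fresh⇒∉ id x#xs) (sym (σ-injective σx≈σy)))
        fpf′ : FixedPointFree ys
        fpf′ y∈ys = fpf (there (y∈ys⇒y∈xs y∈ys))

HasCharacteristic2 : CommutativeRing 0ℓ 0ℓ → Set
HasCharacteristic2 R = 1# + 1# ≈ 0#
  where open CommutativeRing R

-- Identities in a ring of characteristic 2 are decided by the ring solver
-- with coefficients in the Boolean ring 𝔽₂.
module Characteristic2Solver (R : CommutativeRing 0ℓ 0ℓ) (1+1≈0 : HasCharacteristic2 R) where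
  open CommutativeRing R
  open import Algebra.Properties.Group +-group using (inverseʳ-unique; ε⁻¹≈ε)
  open import Algebra.Solver.Ring.AlmostCommutativeRing
    using (fromCommutativeRing; _-Raw-AlmostCommutative⟶_; Induced-equivalence)
  open import Data.Bool as Bool using (Bool; true; false)
  open import Data.Bool.Properties using (xor-∧-commutativeRing)
  open import Data.Maybe using (just; nothing)
  open import Relation.Binary.Definitions using (WeaklyDecidable)

  𝔽₂ : RawRing 0ℓ 0ℓ
  𝔽₂ = CommutativeRing.rawRing xor-∧-commutativeRing

  fromBool : Bool → Carrier
  fromBool true  = 1#
  fromBool false = 0#

  morphism : 𝔽₂ -Raw-AlmostCommutative⟶ fromCommutativeRing R
  morphism = record
    { ⟦_⟧    = fromBool
    ; +-homo = λ { true true → sym 1+1≈0 ; true false → sym (+-identityʳ 1#)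
                 ; false b → sym (+-identityˡ (fromBool b)) }
    ; *-homo = λ { true b → sym (*-identityˡ (fromBool b)) ; false b → sym (zeroˡ (fromBool b)) }
    ; -‿homo = λ { true → inverseʳ-unique 1# 1# 1+1≈0 ; false → sym ε⁻¹≈ε }
    ; 0-homo = refl
    ; 1-homo = refl
    }

  coeff≟ : WeaklyDecidable (Induced-equivalence morphism)
  coeff≟ a b with a Bool.≟ b
  ... | yes ≡.refl = just refl
  ... | no _       = nothing

  open import Algebra.Solver.Ring 𝔽₂ (fromCommutativeRing R) morphism coeff≟ public

  :0 :1 : ∀ {n} → Polynomial n
  :0 = con false
  :1 = con true

module Characteristic2 (R : CommutativeRing 0ℓ 0ℓ) (1+1≈0 : HasCharacteristic2 R) where
  open CommutativeRing R
  open import Algebra.Properties.Semiring.Exp semiring using (_^_; ^-congˡ; ^-assocʳ)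
  open import Relation.Binary.Reasoning.Setoid setoid
  open Characteristic2Solver R 1+1≈0

  x+x≈0 : ∀ x → x + x ≈ 0#
  x+x≈0 = solve 1 (λ x → x :+ x := :0) refl

  x+y+y≈x : ∀ x y → (x + y) + y ≈ x
  x+y+y≈x = solve 2 (λ x y → (x :+ y) :+ y := x) refl

  x+y≈0⇒x≈y : ∀ {x y} → x + y ≈ 0# → x ≈ y
  x+y≈0⇒x≈y {x} {y} x+y≈0 = begin
    x           ≈⟨ x+y+y≈x x y ⟨
    (x + y) + y ≈⟨ +-congʳ x+y≈0 ⟩
    0# + y      ≈⟨ +-identityˡ y ⟩
    y           ∎

  -- Proves identities that hold modulo u = 1, once the solver has checked
  -- x = y + c (u + 1) for an explicit cofactor c.
  x≈y+c*[u+1]⇒x≈y : ∀ {x y c u} → u ≈ 1# → x ≈ y + c * (u + 1#) → x ≈ y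
  x≈y+c*[u+1]⇒x≈y {x} {y} {c} {u} u≈1 x≈y+c*[u+1] = begin
    x                ≈⟨ x≈y+c*[u+1] ⟩
    y + c * (u + 1#) ≈⟨ +-congˡ (*-congˡ (trans (+-congʳ u≈1) 1+1≈0)) ⟩
    y + c * 0#       ≈⟨ solve 2 (λ y c → y :+ c :* :0 := y) refl y c ⟩
    y                ∎

  [x+y]²≈x²+y² : ∀ x y → (x + y) ^ 2 ≈ x ^ 2 + y ^ 2
  [x+y]²≈x²+y² = solve 2 (λ x y → (x :+ y) :^ 2 := x :^ 2 :+ y :^ 2) refl

  frobenius : ∀ k x y → (x + y) ^ (2 ℕ.^ k) ≈ x ^ (2 ℕ.^ k) + y ^ (2 ℕ.^ k)
  frobenius zero    x y = solve 2 (λ x y → (x :+ y) :^ 1 := x :^ 1 :+ y :^ 1) refl x y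
  frobenius (suc k) x y = begin
    (x + y) ^ (2 ℕ.* 2 ℕ.^ k)                 ≈⟨ ^-assocʳ (x + y) 2 (2 ℕ.^ k) ⟨
    ((x + y) ^ 2) ^ (2 ℕ.^ k)                 ≈⟨ ^-congˡ (2 ℕ.^ k) ([x+y]²≈x²+y² x y) ⟩
    (x ^ 2 + y ^ 2) ^ (2 ℕ.^ k)               ≈⟨ frobenius k (x ^ 2) (y ^ 2) ⟩
    (x ^ 2) ^ (2 ℕ.^ k) + (y ^ 2) ^ (2 ℕ.^ k) ≈⟨ +-cong (^-assocʳ x 2 (2 ℕ.^ k)) (^-assocʳ y 2 (2 ℕ.^ k)) ⟩
    x ^ (2 ℕ.* 2 ℕ.^ k) + y ^ (2 ℕ.* 2 ℕ.^ k) ∎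

  x*y≈1⇒x⁹+y⁹≈s³+s : ∀ {x y} → x * y ≈ 1# →
    x ^ 9 + y ^ 9 ≈ (x ^ 3 + y ^ 3) ^ 3 + (x ^ 3 + y ^ 3)
  x*y≈1⇒x⁹+y⁹≈s³+s {x} {y} x*y≈1 = sym (x≈y+c*[u+1]⇒x≈y x*y≈1
    (solve 2 (λ x y → let s = x :^ 3 :+ y :^ 3 ; u = x :* y in
      s :^ 3 :+ s := (x :^ 9 :+ y :^ 9) :+ (s :* (u :* u :+ u :+ :1)) :* (u :+ :1)) refl x y))

  wt+[w+1]t≈t : ∀ w t → w * t + (w + 1#) * t ≈ t
  wt+[w+1]t≈t = solve 2 (λ w t → w :* t :+ (w :+ :1) :* t := t) refl

  [wt]³+[[w+1]t]³≈[w[w+1]+1]t³ : ∀ w t →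
    (w * t) ^ 3 + ((w + 1#) * t) ^ 3 ≈ (w * (w + 1#) + 1#) * t ^ 3
  [wt]³+[[w+1]t]³≈[w[w+1]+1]t³ = solve 2 (λ w t →
    (w :* t) :^ 3 :+ ((w :+ :1) :* t) :^ 3 := (w :* (w :+ :1) :+ :1) :* t :^ 3) refl

  Qβ-identity : ∀ {w t} → (w * (w + 1#)) * (t * t) ≈ 1# → ∀ b u →
    ((b * u) * (w * t) ^ 3 + (b + b * u) * ((w + 1#) * t) ^ 3) + b * (w * t + (w + 1#) * t)
      ≈ (b * (u + w + 1#)) * ((w * t) ^ 3 + ((w + 1#) * t) ^ 3)
  Qβ-identity {w} {t} norm b u = x≈y+c*[u+1]⇒x≈y norm (solve 4 (λ w t b u →
    let z = w :* t ; z̄ = (w :+ :1) :* t in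
    ((b :* u) :* z :^ 3 :+ (b :+ b :* u) :* z̄ :^ 3) :+ b :* (z :+ z̄)
      := (b :* (u :+ w :+ :1)) :* (z :^ 3 :+ z̄ :^ 3) :+ (b :* t) :* ((w :* (w :+ :1)) :* (t :* t) :+ :1))
    refl w t b u)

  Φ-identity : ∀ {a i r} → a * i ≈ 1# → r * r ≈ a + 1# → 1# + (i * r ^ 3) ^ 2 ≈ (a + i) + i ^ 2
  Φ-identity {a} {i} {r} a*i≈1 r*r≈a+1 = begin
    1# + (i * r ^ 3) ^ 2
      ≈⟨ solve 2 (λ i r → :1 :+ (i :* r :^ 3) :^ 2 := :1 :+ i :^ 2 :* (r :* r) :^ 3) refl i r ⟩
    1# + i ^ 2 * (r * r) ^ 3
      ≈⟨ +-congˡ (*-congˡ (^-congˡ 3 r*r≈a+1)) ⟩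
    1# + i ^ 2 * (a + 1#) ^ 3
      ≈⟨ x≈y+c*[u+1]⇒x≈y a*i≈1 (solve 2 (λ a i → let u = a :* i in
           :1 :+ i :^ 2 :* (a :+ :1) :^ 3
             := ((a :+ i) :+ i :^ 2) :+ (a :* (u :+ :1) :+ u :+ :1 :+ i) :* (u :+ :1)) refl a i) ⟩
    (a + i) + i ^ 2
      ∎

module FieldProperties {n : ℕ} (F : FiniteField n) where
  open FiniteField F
  open import Algebra.Properties.Group +-group
    using (ε⁻¹≈ε) renaming (⁻¹-injective to -‿injective; ⁻¹-involutive to -‿involutive)
  open import Data.List.Fresh using (List#; length; fromList)
  open import Data.List.Fresh.Membership.Setoid setoid using (_∈_)
  open import Data.List.Fresh.Relation.Unary.Any using (_─_)
  open import Data.List.Fresh.Relation.Unary.Any.Properties using (length-remove)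
  open import Data.List.Fresh.Membership.Setoid.Properties setoid using (≈-subst-∈; ∈-remove; ∉-remove)
  open import Relation.Binary.Reasoning.Setoid setoid

  x*y≈1⇒x≉0 : ∀ {x y} → x * y ≈ 1# → x ≉ 0#
  x*y≈1⇒x≉0 {x} {y} x*y≈1 x≈0 = 1≉0 (begin
    1#     ≈⟨ x*y≈1 ⟨
    x * y  ≈⟨ *-congʳ x≈0 ⟩
    0# * y ≈⟨ zeroˡ y ⟩
    0#     ∎)

  x⁻¹*x≈1 : ∀ {x} → x ≉ 0# → x ⁻¹ * x ≈ 1#
  x⁻¹*x≈1 {x} x≉0 = trans (*-comm (x ⁻¹) x) (inverseʳ x x≉0)

  *-cancelˡ : ∀ {x y z} → x ≉ 0# → x * y ≈ x * z → y ≈ z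
  *-cancelˡ {x} {y} {z} x≉0 x*y≈x*z = begin
    y              ≈⟨ *-identityˡ y ⟨
    1# * y         ≈⟨ *-congʳ (x⁻¹*x≈1 x≉0) ⟨
    (x ⁻¹ * x) * y ≈⟨ *-assoc (x ⁻¹) x y ⟩
    x ⁻¹ * (x * y) ≈⟨ *-congˡ x*y≈x*z ⟩
    x ⁻¹ * (x * z) ≈⟨ *-assoc (x ⁻¹) x z ⟨
    (x ⁻¹ * x) * z ≈⟨ *-congʳ (x⁻¹*x≈1 x≉0) ⟩
    1# * z         ≈⟨ *-identityˡ z ⟩
    z              ∎

  x*y≈1⇒y≈x⁻¹ : ∀ {x y} → x * y ≈ 1# → y ≈ x ⁻¹
  x*y≈1⇒y≈x⁻¹ {x} x*y≈1 =
    *-cancelˡ (x*y≈1⇒x≉0 x*y≈1) (trans x*y≈1 (sym (inverseʳ x (x*y≈1⇒x≉0 x*y≈1))))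

  x*y≈0⇒y≈0 : ∀ {x y} → x ≉ 0# → x * y ≈ 0# → y ≈ 0#
  x*y≈0⇒y≈0 {x} x≉0 x*y≈0 = *-cancelˡ x≉0 (trans x*y≈0 (sym (zeroʳ x)))

  x*x≈0⇒x≈0 : ∀ {x} → x * x ≈ 0# → x ≈ 0#
  x*x≈0⇒x≈0 {x} x*x≈0 with x ≟ 0#
  ... | yes x≈0 = x≈0
  ... | no  x≉0 = x*y≈0⇒y≈0 x≉0 x*x≈0

  *-≉0 : ∀ {x y} → x ≉ 0# → y ≉ 0# → x * y ≉ 0#
  *-≉0 x≉0 y≉0 x*y≈0 = y≉0 (x*y≈0⇒y≈0 x≉0 x*y≈0)

  ⁻¹-≉0 : ∀ {x} → x ≉ 0# → x ⁻¹ ≉ 0#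
  ⁻¹-≉0 {x} x≉0 = x*y≈1⇒x≉0 (x⁻¹*x≈1 x≉0)

  ⁻¹-cong : ∀ {x y} → x ≉ 0# → x ≈ y → x ⁻¹ ≈ y ⁻¹
  ⁻¹-cong {x} x≉0 x≈y = x*y≈1⇒y≈x⁻¹ (trans (*-congʳ (sym x≈y)) (inverseʳ x x≉0))

  1⁻¹≈1 : 1# ⁻¹ ≈ 1#
  1⁻¹≈1 = sym (x*y≈1⇒y≈x⁻¹ (*-identityˡ 1#))

  ⁻¹-involutive : ∀ {x} → x ≉ 0# → (x ⁻¹) ⁻¹ ≈ x
  ⁻¹-involutive x≉0 = sym (x*y≈1⇒y≈x⁻¹ (x⁻¹*x≈1 x≉0))

  *-cancelʳ : ∀ {x y z} → z ≉ 0# → x * z ≈ y * z → x ≈ y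
  *-cancelʳ {x} {y} {z} z≉0 x*z≈y*z =
    *-cancelˡ z≉0 (trans (*-comm z x) (trans x*z≈y*z (*-comm y z)))

  -- If 1 + 1 ≉ 0 then y ↦ - y pairs off the nonzero elements, so n is odd.
  2∣n⇒1+1≈0 : 2 ∣ n → 1# + 1# ≈ 0#
  2∣n⇒1+1≈0 2∣n with (1# + 1#) ≟ 0#
  ... | yes 1+1≈0 = 1+1≈0
  ... | no  1+1≉0 = contradiction (∣1⇒≡1 (∣m+n∣m⇒∣n 2∣|ys|+1 2∣|ys|)) λ ()
    where
    xs : List# Carrier _≉_
    xs = fromList distinct
    0∈xs : 0# ∈ xs
    0∈xs = ∈-fromList⁺ setoid distinct (complete 0#)
    ys : List# Carrier _≉_
    ys = xs ─ 0∈xs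
    y∈ys⇒y≉0 : ∀ {y} → y ∈ ys → y ≉ 0#
    y∈ys⇒y≉0 y∈ys y≈0 = ∉-remove id id 0∈xs (≈-subst-∈ y≈0 y∈ys)
    -y≈y⇒y≈0 : ∀ {y} → - y ≈ y → y ≈ 0#
    -y≈y⇒y≈0 {y} -y≈y = x*y≈0⇒y≈0 1+1≉0 (begin
      (1# + 1#) * y   ≈⟨ distribʳ y 1# 1# ⟩
      1# * y + 1# * y ≈⟨ +-cong (*-identityˡ y) (*-identityˡ y) ⟩
      y + y           ≈⟨ +-congˡ -y≈y ⟨
      y + - y         ≈⟨ -‿inverseʳ y ⟩
      0#              ∎)
    closed : ∀ {y} → y ∈ ys → - y ∈ ys
    closed {y} y∈ys = ∈-remove 0∈xs (∈-fromList⁺ setoid distinct (complete (- y)))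
      (λ 0≈-y → y∈ys⇒y≉0 y∈ys (-‿injective (trans (sym 0≈-y) (sym ε⁻¹≈ε))))
    2∣|ys| : 2 ∣ length ys
    2∣|ys| = fixedPointFree-involution⇒2∣length setoid -‿cong -‿involutive ys closed
      (λ y∈ys -y≈y → y∈ys⇒y≉0 y∈ys (-y≈y⇒y≈0 -y≈y))
    |ys|+1≡n : length ys ℕ.+ 1 ≡ n
    |ys|+1≡n = ≡.trans (ℕₚ.+-comm (length ys) 1)
      (≡.trans (≡.sym (length-remove 0∈xs)) (≡.trans (length-fromList setoid distinct) size))
    2∣|ys|+1 : 2 ∣ length ys ℕ.+ 1
    2∣|ys|+1 = ≡.subst (2 ∣_) (≡.sym |ys|+1≡n) 2∣n

module Characteristic2Field {n : ℕ} (F : FiniteField n) (1+1≈0 : HasCharacteristic2 (FiniteField.cring F)) where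
  open FiniteField F
  open FieldProperties F
  open import Algebra.Properties.Semiring.Exp semiring using (_^_)
  open import Relation.Binary.Reasoning.Setoid setoid
  open Characteristic2 cring 1+1≈0
  open Characteristic2Solver cring 1+1≈0 using (solve; _:=_; _:+_; _:*_; _:^_; :1)

  x*x≈y*y⇒x≈y : ∀ {x y} → x * x ≈ y * y → x ≈ y
  x*x≈y*y⇒x≈y {x} {y} x*x≈y*y = x+y≈0⇒x≈y (x*x≈0⇒x≈0 (begin
    (x + y) * (x + y) ≈⟨ solve 2 (λ x y → (x :+ y) :* (x :+ y) := x :* x :+ y :* y) refl x y ⟩
    x * x + y * y     ≈⟨ +-congʳ x*x≈y*y ⟩
    y * y + y * y     ≈⟨ x+x≈0 (y * y) ⟩
    0#                ∎))

  x²+x≈y²+y⇒x≈y⊎x≈y+1 : ∀ {x y} → x ^ 2 + x ≈ y ^ 2 + y → x ≈ y ⊎ x ≈ y + 1#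
  x²+x≈y²+y⇒x≈y⊎x≈y+1 {x} {y} x²+x≈y²+y with (x + y) ≟ 0#
  ... | yes x+y≈0 = inj₁ (x+y≈0⇒x≈y x+y≈0)
  ... | no  x+y≉0 = inj₂ (begin
    x            ≈⟨ solve 2 (λ x y → x := ((x :+ y) :+ :1) :+ (y :+ :1)) refl x y ⟩
    ((x + y) + 1#) + (y + 1#) ≈⟨ +-congʳ (x*y≈0⇒y≈0 x+y≉0 product≈0) ⟩
    0# + (y + 1#)             ≈⟨ +-identityˡ (y + 1#) ⟩
    y + 1#                    ∎)
    where
    product≈0 : (x + y) * ((x + y) + 1#) ≈ 0#
    product≈0 = begin
      (x + y) * ((x + y) + 1#)    ≈⟨ solve 2 (λ x y → (x :+ y) :* ((x :+ y) :+ :1) := (x :^ 2 :+ x) :+ (y :^ 2 :+ y)) refl x y ⟩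
      (x ^ 2 + x) + (y ^ 2 + y)   ≈⟨ +-congʳ x²+x≈y²+y ⟩
      (y ^ 2 + y) + (y ^ 2 + y)   ≈⟨ x+x≈0 (y ^ 2 + y) ⟩
      0#                          ∎

module SetupProperties (e : ℕ) {{e≢0 : NonZero e}} (F : FiniteField ((2 ℕ.^ e) ℕ.^ 2)) where
  open Setup e F
  open import Data.List using (_∷_)
  import Data.List.Relation.Unary.Any as List using (Any; tail)
  open import Data.List.Membership.Setoid setoid using (lose)
  open FieldProperties F
  open import Algebra.Properties.CommutativeSemiring.Exp commutativeSemiring
    using (_^_; ^-congˡ; ^-homo-*; ^-assocʳ; ^-distrib-*)
  open import Relation.Binary.Reasoning.Setoid setoid

  q≡2*2^[e-1] : q ≡ 2 ℕ.* 2 ℕ.^ ℕ.pred e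
  q≡2*2^[e-1] = ≡.cong (2 ℕ.^_) (≡.sym (ℕₚ.suc-pred e))

  1+1≈0 : 1# + 1# ≈ 0#
  1+1≈0 = 2∣n⇒1+1≈0 (∣-trans 2∣q (m∣m*n (q ℕ.^ 1)))
    where
    2∣q : 2 ∣ q
    2∣q = ≡.subst (2 ∣_) (≡.sym q≡2*2^[e-1]) (m∣m*n (2 ℕ.^ ℕ.pred e))

  open Characteristic2 cring 1+1≈0
  open Characteristic2Field F 1+1≈0
  open Characteristic2Solver cring 1+1≈0 using (solve; _:=_; _:+_; _:*_; _:^_; :0; :1)

  ^ᶠ≡^ : ∀ x n → x ^ᶠ n ≡ x ^ n
  ^ᶠ≡^ x zero    = ≡.refl
  ^ᶠ≡^ x (suc n) = ≡.cong (x *_) (^ᶠ≡^ x n)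

  ^ᶠ-congˡ : ∀ n {x y} → x ≈ y → x ^ᶠ n ≈ y ^ᶠ n
  ^ᶠ-congˡ n {x} {y} rewrite ^ᶠ≡^ x n | ^ᶠ≡^ y n = ^-congˡ n

  ^ᶠ-homo-* : ∀ x m n → x ^ᶠ (m ℕ.+ n) ≈ x ^ᶠ m * x ^ᶠ n
  ^ᶠ-homo-* x m n rewrite ^ᶠ≡^ x (m ℕ.+ n) | ^ᶠ≡^ x m | ^ᶠ≡^ x n = ^-homo-* x m n

  ^ᶠ-assocʳ : ∀ x m n → (x ^ᶠ m) ^ᶠ n ≈ x ^ᶠ (m ℕ.* n)
  ^ᶠ-assocʳ x m n rewrite ^ᶠ≡^ (x ^ᶠ m) n | ^ᶠ≡^ x m | ^ᶠ≡^ x (m ℕ.* n) = ^-assocʳ x m n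

  ^ᶠ-distrib-* : ∀ x y n → (x * y) ^ᶠ n ≈ x ^ᶠ n * y ^ᶠ n
  ^ᶠ-distrib-* x y n rewrite ^ᶠ≡^ (x * y) n | ^ᶠ≡^ x n | ^ᶠ≡^ y n = ^-distrib-* x y n

  ^ᶠ-frobenius : ∀ k x y → (x + y) ^ᶠ (2 ℕ.^ k) ≈ x ^ᶠ (2 ℕ.^ k) + y ^ᶠ (2 ℕ.^ k)
  ^ᶠ-frobenius k x y rewrite ^ᶠ≡^ (x + y) (2 ℕ.^ k) | ^ᶠ≡^ x (2 ℕ.^ k) | ^ᶠ≡^ y (2 ℕ.^ k) = frobenius k x y

  1^ᶠn≈1 : ∀ n → 1# ^ᶠ n ≈ 1#
  1^ᶠn≈1 zero    = refl
  1^ᶠn≈1 (suc n) = trans (*-identityˡ (1# ^ᶠ n)) (1^ᶠn≈1 n)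

  ^ᶠ-≉0 : ∀ n {x} → x ≉ 0# → x ^ᶠ n ≉ 0#
  ^ᶠ-≉0 zero    x≉0 = 1≉0
  ^ᶠ-≉0 (suc n) x≉0 = *-≉0 x≉0 (^ᶠ-≉0 n x≉0)

  conj-cong : ∀ {x y} → x ≈ y → conj x ≈ conj y
  conj-cong = ^ᶠ-congˡ q

  conj-+ : ∀ x y → conj (x + y) ≈ conj x + conj y
  conj-+ = ^ᶠ-frobenius e

  conj-* : ∀ x y → conj (x * y) ≈ conj x * conj y
  conj-* x y = ^ᶠ-distrib-* x y q

  conj-1 : conj 1# ≈ 1#
  conj-1 = 1^ᶠn≈1 q

  conj-^ᶠ : ∀ n x → conj (x ^ᶠ n) ≈ conj x ^ᶠ n
  conj-^ᶠ zero    x = conj-1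
  conj-^ᶠ (suc n) x = trans (conj-* x (x ^ᶠ n)) (*-congˡ (conj-^ᶠ n x))

  conj-⁻¹ : ∀ {x} → x ≉ 0# → conj (x ⁻¹) ≈ conj x ⁻¹
  conj-⁻¹ {x} x≉0 = x*y≈1⇒y≈x⁻¹ (begin
    conj x * conj (x ⁻¹) ≈⟨ conj-* x (x ⁻¹) ⟨
    conj (x * x ⁻¹)      ≈⟨ conj-cong (inverseʳ x x≉0) ⟩
    conj 1#              ≈⟨ conj-1 ⟩
    1#                   ∎)

  InFq-resp : ∀ {x y} → x ≈ y → InFq x → InFq y
  InFq-resp x≈y x∈Fq = trans (conj-cong (sym x≈y)) (trans x∈Fq x≈y)

  InFq-1 : InFq 1#
  InFq-1 = conj-1

  InFq-+ : ∀ {x y} → InFq x → InFq y → InFq (x + y)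
  InFq-+ {x} {y} x∈Fq y∈Fq = trans (conj-+ x y) (+-cong x∈Fq y∈Fq)

  InFq-^ᶠ : ∀ n {x} → InFq x → InFq (x ^ᶠ n)
  InFq-^ᶠ n {x} x∈Fq = trans (conj-^ᶠ n x) (^ᶠ-congˡ n x∈Fq)

  InFq-⁻¹ : ∀ {x} → x ≉ 0# → InFq x → InFq (x ⁻¹)
  InFq-⁻¹ x≉0 x∈Fq = trans (conj-⁻¹ x≉0) (⁻¹-cong (^ᶠ-≉0 q x≉0) x∈Fq)

  IsSqrt : Carrier → Carrier → Set
  IsSqrt a y = InFq y × y * y ≈ a

  IsSqrt-resp : ∀ {a y z} → y ≈ z → IsSqrt a y → IsSqrt a z
  IsSqrt-resp y≈z (y∈Fq , y*y≈a) = InFq-resp y≈z y∈Fq , trans (*-cong (sym y≈z) (sym y≈z)) y*y≈a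

  searchSqrt-spec : ∀ {a} ys → List.Any (IsSqrt a) ys → IsSqrt a (searchSqrt a ys)
  searchSqrt-spec {a} (y ∷ ys) y∈ys with (y ^ᶠ q) ≟ y | (y * y) ≟ a
  ... | yes y∈Fq | yes y*y≈a = y∈Fq , y*y≈a
  ... | yes _    | no  y*y≉a = searchSqrt-spec ys (List.tail (y*y≉a ∘ proj₂) y∈ys)
  ... | no  y∉Fq | _         = searchSqrt-spec ys (List.tail (y∉Fq ∘ proj₁) y∈ys)

  sqrt-spec : ∀ {a} → InFq a → IsSqrt a (sqrt a)
  sqrt-spec {a} a∈Fq = searchSqrt-spec elements (lose IsSqrt-resp (complete y) (y∈Fq , y*y≈a))
    where
    h : ℕ
    h = 2 ℕ.^ ℕ.pred e
    y : Carrier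
    y = a ^ᶠ h
    y∈Fq : InFq y
    y∈Fq = begin
      (a ^ᶠ h) ^ᶠ q    ≈⟨ ^ᶠ-assocʳ a h q ⟩
      a ^ᶠ (h ℕ.* q)   ≡⟨ ≡.cong (a ^ᶠ_) (ℕₚ.*-comm h q) ⟩
      a ^ᶠ (q ℕ.* h)   ≈⟨ ^ᶠ-assocʳ a q h ⟨
      (a ^ᶠ q) ^ᶠ h    ≈⟨ ^ᶠ-congˡ h a∈Fq ⟩
      a ^ᶠ h           ∎
    y*y≈a : y * y ≈ a
    y*y≈a = begin
      y * y            ≈⟨ *-congˡ (*-identityʳ y) ⟨
      (a ^ᶠ h) ^ᶠ 2    ≈⟨ ^ᶠ-assocʳ a h 2 ⟩
      a ^ᶠ (h ℕ.* 2)   ≡⟨ ≡.cong (a ^ᶠ_) (≡.trans (ℕₚ.*-comm h 2) (≡.sym q≡2*2^[e-1])) ⟩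
      a ^ᶠ q           ≈⟨ a∈Fq ⟩
      a                ∎

  trAux-cong : ∀ k {a b} → a ≈ b → trAux k a ≈ trAux k b
  trAux-cong zero    a≈b = refl
  trAux-cong (suc k) a≈b = +-cong (^ᶠ-congˡ (2 ℕ.^ k) a≈b) (trAux-cong k a≈b)

  trAux-x²+x : ∀ k x → trAux k (x ^ᶠ 2 + x) ≈ x ^ᶠ (2 ℕ.^ k) + x
  trAux-x²+x zero    x = solve 1 (λ x → :0 := x :^ 1 :+ x) refl x
  trAux-x²+x (suc k) x = begin
    (x ^ᶠ 2 + x) ^ᶠ (2 ℕ.^ k) + trAux k (x ^ᶠ 2 + x)
      ≈⟨ +-cong (^ᶠ-frobenius k (x ^ᶠ 2) x) (trAux-x²+x k x) ⟩
    ((x ^ᶠ 2) ^ᶠ (2 ℕ.^ k) + x ^ᶠ (2 ℕ.^ k)) + (x ^ᶠ (2 ℕ.^ k) + x)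
      ≈⟨ +-congʳ (+-congʳ (^ᶠ-assocʳ x 2 (2 ℕ.^ k))) ⟩
    (x ^ᶠ (2 ℕ.* 2 ℕ.^ k) + x ^ᶠ (2 ℕ.^ k)) + (x ^ᶠ (2 ℕ.^ k) + x)
      ≈⟨ solve 3 (λ a b x → (a :+ b) :+ (b :+ x) := a :+ x) refl _ _ x ⟩
    x ^ᶠ (2 ℕ.* 2 ℕ.^ k) + x
      ∎

  A≉0 : ∀ {λ' x} → Tr λ' ≈ 1# → InFq x → A λ' x ≉ 0#
  A≉0 {λ'} {x} Trλ≈1 x∈Fq A≈0 = 1≉0 (begin
    1#              ≈⟨ Trλ≈1 ⟨
    Tr λ'           ≈⟨ trAux-cong e (x+y≈0⇒x≈y A≈0) ⟨
    Tr (x ^ᶠ 2 + x) ≈⟨ trAux-x²+x e x ⟩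
    x ^ᶠ q + x      ≈⟨ +-congʳ x∈Fq ⟩
    x + x           ≈⟨ x+x≈0 x ⟩
    0#              ∎)

  conj-θ : ∀ {λ' θ} → InFq λ' → ¬ InFq θ → ((θ ^ᶠ 2 + θ) + λ') + 1# ≈ 0# → conj θ ≈ θ + 1#
  conj-θ {λ'} {θ} λ∈Fq θ∉Fq θ-root =
    fromInj₂ (λ conjθ≈θ → contradiction conjθ≈θ θ∉Fq) (x²+x≈y²+y⇒x≈y⊎x≈y+1 (begin
      conj θ ^ᶠ 2 + conj θ   ≈⟨ +-congʳ (conj-^ᶠ 2 θ) ⟨
      conj (θ ^ᶠ 2) + conj θ ≈⟨ conj-+ (θ ^ᶠ 2) θ ⟨
      conj (θ ^ᶠ 2 + θ)      ≈⟨ conj-cong θ²+θ≈λ+1 ⟩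
      conj (λ' + 1#)         ≈⟨ InFq-+ λ∈Fq InFq-1 ⟩
      λ' + 1#                ≈⟨ θ²+θ≈λ+1 ⟨
      θ ^ᶠ 2 + θ             ∎))
    where
    θ²+θ≈λ+1 : θ ^ᶠ 2 + θ ≈ λ' + 1#
    θ²+θ≈λ+1 = x+y≈0⇒x≈y (trans (sym (+-assoc (θ ^ᶠ 2 + θ) λ' 1#)) θ-root)

  module _ {z : Carrier} (z∈μ : InMu z) where

    InMu⇒z*conjz≈1 : z * conj z ≈ 1#
    InMu⇒z*conjz≈1 = begin
      z * conj z        ≈⟨ *-comm z (conj z) ⟩
      conj z * z        ≈⟨ *-congˡ (*-identityʳ z) ⟨
      conj z * (z * 1#) ≈⟨ ^ᶠ-homo-* z q 1 ⟨
      z ^ᶠ (q ℕ.+ 1)    ≈⟨ z∈μ ⟩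
      1#                ∎

    InMu⇒≉0 : z ≉ 0#
    InMu⇒≉0 = x*y≈1⇒x≉0 InMu⇒z*conjz≈1

    InMu⇒conj≈⁻¹ : conj z ≈ z ⁻¹
    InMu⇒conj≈⁻¹ = x*y≈1⇒y≈x⁻¹ InMu⇒z*conjz≈1

    InMu⇒z+z⁻¹∈Fq : InFq (z + z ⁻¹)
    InMu⇒z+z⁻¹∈Fq = begin
      conj (z + z ⁻¹)      ≈⟨ conj-+ z (z ⁻¹) ⟩
      conj z + conj (z ⁻¹) ≈⟨ +-cong InMu⇒conj≈⁻¹ conj-z⁻¹ ⟩
      z ⁻¹ + z             ≈⟨ +-comm (z ⁻¹) z ⟩
      z + z ⁻¹             ∎
      where
      conj-z⁻¹ : conj (z ⁻¹) ≈ z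
      conj-z⁻¹ = begin
        conj (z ⁻¹) ≈⟨ conj-⁻¹ InMu⇒≉0 ⟩
        conj z ⁻¹   ≈⟨ ⁻¹-cong (^ᶠ-≉0 q InMu⇒≉0) InMu⇒conj≈⁻¹ ⟩
        (z ⁻¹) ⁻¹   ≈⟨ ⁻¹-involutive InMu⇒≉0 ⟩
        z           ∎

  InMu*⇒z+z⁻¹≉0 : ∀ {z} → InMu* z → z + z ⁻¹ ≉ 0#
  InMu*⇒z+z⁻¹≉0 {z} (z∈μ , z≉1) z+z⁻¹≈0 = z≉1 (x*x≈y*y⇒x≈y (begin
    z * z    ≈⟨ *-congˡ (x+y≈0⇒x≈y z+z⁻¹≈0) ⟩
    z * z ⁻¹ ≈⟨ inverseʳ z (InMu⇒≉0 z∈μ) ⟩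
    1#       ≈⟨ *-identityˡ 1# ⟨
    1# * 1#  ∎))

  module Construction {λ' θ : Carrier} (λ∈Fq : InFq λ') (Trλ≈1 : Tr λ' ≈ 1#) (θ∉Fq : ¬ InFq θ)
                      (θ-root : ((θ ^ᶠ 2 + θ) + λ') + 1# ≈ 0#) where

    module Point {x : Carrier} (x∈Fq : InFq x) where
      w r t z z̄ : Carrier
      w = x + θ
      r = sqrt (A λ' x + 1#)
      t = r ⁻¹
      z = zx λ' θ x
      z̄ = (w + 1#) * t

      A+1≈w[w+1] : A λ' x + 1# ≈ w * (w + 1#)
      A+1≈w[w+1] = begin
        ((x ^ᶠ 2 + x) + λ') + 1#
          ≈⟨ solve 3 (λ x θ λ' → ((x :^ 2 :+ x) :+ λ') :+ :1
                                   := (x :+ θ) :* ((x :+ θ) :+ :1) :+ (((θ :^ 2 :+ θ) :+ λ') :+ :1))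
                     refl x θ λ' ⟩
        w * (w + 1#) + (((θ ^ᶠ 2 + θ) + λ') + 1#)
          ≈⟨ +-congˡ θ-root ⟩
        w * (w + 1#) + 0#
          ≈⟨ +-identityʳ (w * (w + 1#)) ⟩
        w * (w + 1#)
          ∎

      conj-w : conj w ≈ w + 1#
      conj-w = begin
        conj (x + θ)       ≈⟨ conj-+ x θ ⟩
        conj x + conj θ    ≈⟨ +-cong x∈Fq (conj-θ λ∈Fq θ∉Fq θ-root) ⟩
        x + (θ + 1#)       ≈⟨ +-assoc x θ 1# ⟨
        w + 1#             ∎

      w≉0 : w ≉ 0#
      w≉0 w≈0 = θ∉Fq (InFq-resp (x+y≈0⇒x≈y w≈0) x∈Fq)

      w+1≉0 : w + 1# ≉ 0#
      w+1≉0 w+1≈0 = ^ᶠ-≉0 q w≉0 (trans conj-w w+1≈0)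

      r-spec : IsSqrt (A λ' x + 1#) r
      r-spec = sqrt-spec (InFq-+ (InFq-+ (InFq-+ (InFq-^ᶠ 2 x∈Fq) x∈Fq) λ∈Fq) InFq-1)

      r*r≈w[w+1] : r * r ≈ w * (w + 1#)
      r*r≈w[w+1] = trans (proj₂ r-spec) A+1≈w[w+1]

      r≉0 : r ≉ 0#
      r≉0 r≈0 = *-≉0 w≉0 w+1≉0 (trans (sym r*r≈w[w+1]) (trans (*-congʳ r≈0) (zeroˡ r)))

      r*t≈1 : r * t ≈ 1#
      r*t≈1 = inverseʳ r r≉0

      t≉0 : t ≉ 0#
      t≉0 = ⁻¹-≉0 r≉0

      t∈Fq : InFq t
      t∈Fq = InFq-⁻¹ r≉0 (proj₁ r-spec)

      norm : (w * (w + 1#)) * (t * t) ≈ 1#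
      norm = begin
        (w * (w + 1#)) * (t * t) ≈⟨ *-congʳ r*r≈w[w+1] ⟨
        (r * r) * (t * t)        ≈⟨ solve 2 (λ r t → (r :* r) :* (t :* t) := (r :* t) :* (r :* t)) refl r t ⟩
        (r * t) * (r * t)        ≈⟨ *-cong r*t≈1 r*t≈1 ⟩
        1# * 1#                  ≈⟨ *-identityˡ 1# ⟩
        1#                       ∎

      z*z̄≈1 : z * z̄ ≈ 1#
      z*z̄≈1 = trans (solve 2 (λ w t → (w :* t) :* ((w :+ :1) :* t) := (w :* (w :+ :1)) :* (t :* t)) refl w t) norm

      z⁻¹≈z̄ : z ⁻¹ ≈ z̄
      z⁻¹≈z̄ = sym (x*y≈1⇒y≈x⁻¹ z*z̄≈1)

      z≉0 : z ≉ 0#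
      z≉0 = x*y≈1⇒x≉0 z*z̄≈1

      conj-z : conj z ≈ z̄
      conj-z = trans (conj-* w t) (*-cong conj-w t∈Fq)

      tx≈t : tx λ' θ x ≈ t
      tx≈t = trans (+-congˡ z⁻¹≈z̄) (wt+[w+1]t≈t w t)

      z∈μ* : InMu* z
      z∈μ* = z^[q+1]≈1 , z≉1
        where
        z^[q+1]≈1 : z ^ᶠ (q ℕ.+ 1) ≈ 1#
        z^[q+1]≈1 = begin
          z ^ᶠ (q ℕ.+ 1)         ≈⟨ ^ᶠ-homo-* z q 1 ⟩
          conj z * (z * 1#)      ≈⟨ *-cong conj-z (*-identityʳ z) ⟩
          z̄ * z                  ≈⟨ *-comm z̄ z ⟩
          z * z̄                  ≈⟨ z*z̄≈1 ⟩
          1#                     ∎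
        z≉1 : z ≉ 1#
        z≉1 z≈1 = t≉0 (begin
          t             ≈⟨ tx≈t ⟨
          z + z ⁻¹      ≈⟨ +-cong z≈1 (trans (⁻¹-cong z≉0 z≈1) 1⁻¹≈1) ⟩
          1# + 1#       ≈⟨ 1+1≈0 ⟩
          0#            ∎)

      A≈w[w+1]+1 : A λ' x ≈ w * (w + 1#) + 1#
      A≈w[w+1]+1 = trans (sym (x+y+y≈x (A λ' x) 1#)) (+-congʳ A+1≈w[w+1])

      sx≈At³ : sx λ' θ x ≈ A λ' x * t ^ᶠ 3
      sx≈At³ = begin
        z ^ᶠ 3 + (z ⁻¹) ^ᶠ 3                   ≈⟨ +-congˡ (^ᶠ-congˡ 3 z⁻¹≈z̄) ⟩
        z ^ᶠ 3 + z̄ ^ᶠ 3                        ≈⟨ [wt]³+[[w+1]t]³≈[w[w+1]+1]t³ w t ⟩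
        (w * (w + 1#) + 1#) * t ^ᶠ 3           ≈⟨ *-congʳ A≈w[w+1]+1 ⟨
        A λ' x * t ^ᶠ 3                        ∎

      sx≉0 : sx λ' θ x ≉ 0#
      sx≉0 sx≈0 = *-≉0 (A≉0 Trλ≈1 x∈Fq) (^ᶠ-≉0 3 t≉0) (trans (sym sx≈At³) sx≈0)

      P[z]≈α[s³+s] : ∀ α → P α z ≈ α * (sx λ' θ x ^ᶠ 3 + sx λ' θ x)
      P[z]≈α[s³+s] α = *-congˡ (x*y≈1⇒x⁹+y⁹≈s³+s (inverseʳ z z≉0))

      Q[z]≈b[c+x+1]s : ∀ {β c} → β ≈ (β + conj β) * (c + θ) →
        Q β z ≈ ((β + conj β) * ((c + x) + 1#)) * sx λ' θ x
      Q[z]≈b[c+x+1]s {β} {c} β≈bu = begin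
        (β * z ^ᶠ 3 + conj β * (z ⁻¹) ^ᶠ 3) + b * (z + z ⁻¹)
          ≈⟨ +-cong (+-cong (*-congʳ β≈bu) (*-cong conjβ≈b+bu (^ᶠ-congˡ 3 z⁻¹≈z̄))) (*-congˡ (+-congˡ z⁻¹≈z̄)) ⟩
        ((b * u) * z ^ᶠ 3 + (b + b * u) * z̄ ^ᶠ 3) + b * (z + z̄)
          ≈⟨ Qβ-identity norm b u ⟩
        (b * (u + w + 1#)) * (z ^ᶠ 3 + z̄ ^ᶠ 3)
          ≈⟨ *-cong (*-congˡ (solve 3 (λ c θ x → (c :+ x) :+ :1 := ((c :+ θ) :+ (x :+ θ)) :+ :1) refl c θ x))
                    (+-congˡ (^ᶠ-congˡ 3 z⁻¹≈z̄)) ⟨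
        (b * ((c + x) + 1#)) * sx λ' θ x
          ∎
        where
        b u : Carrier
        b = β + conj β
        u = c + θ
        conjβ≈b+bu : conj β ≈ b + b * u
        conjβ≈b+bu = trans (solve 2 (λ β β̄ → β̄ := (β :+ β̄) :+ β) refl β (conj β)) (+-congˡ β≈bu)

      1+s⁻²≈Φ : 1# + (sx λ' θ x ⁻¹) ^ᶠ 2 ≈ Φ λ' x
      1+s⁻²≈Φ = trans (+-congˡ (^ᶠ-congˡ 2 sx⁻¹≈A⁻¹r³)) (Φ-identity A*A⁻¹≈1 (proj₂ r-spec))
        where
        A*A⁻¹≈1 : A λ' x * A λ' x ⁻¹ ≈ 1#
        A*A⁻¹≈1 = inverseʳ (A λ' x) (A≉0 Trλ≈1 x∈Fq)
        sx⁻¹≈A⁻¹r³ : sx λ' θ x ⁻¹ ≈ A λ' x ⁻¹ * r ^ᶠ 3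
        sx⁻¹≈A⁻¹r³ = sym (x*y≈1⇒y≈x⁻¹ (begin
          sx λ' θ x * (A λ' x ⁻¹ * r ^ᶠ 3)         ≈⟨ *-congʳ sx≈At³ ⟩
          (A λ' x * t ^ᶠ 3) * (A λ' x ⁻¹ * r ^ᶠ 3) ≈⟨ solve 4 (λ a t a⁻¹ r → (a :* t :^ 3) :* (a⁻¹ :* r :^ 3)
                                                        := (a :* a⁻¹) :* (r :* t) :^ 3) refl (A λ' x) t (A λ' x ⁻¹) r ⟩
          (A λ' x * A λ' x ⁻¹) * (r * t) ^ᶠ 3      ≈⟨ *-cong A*A⁻¹≈1 (trans (^ᶠ-congˡ 3 r*t≈1) (1^ᶠn≈1 3)) ⟩
          1# * 1#                                  ≈⟨ *-identityˡ 1# ⟩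
          1#                                       ∎))

    zx-injective : ∀ x y → InFq x → InFq y → zx λ' θ x ≈ zx λ' θ y → x ≈ y
    zx-injective x y x∈Fq y∈Fq zx≈zy = begin
      x               ≈⟨ x+y+y≈x x θ ⟨
      X.w + θ         ≈⟨ +-congʳ wx≈wy ⟩
      Y.w + θ         ≈⟨ x+y+y≈x y θ ⟩
      y               ∎
      where
      module X = Point x∈Fq
      module Y = Point y∈Fq
      tx≈ty : X.t ≈ Y.t
      tx≈ty = trans (sym X.tx≈t) (trans (+-cong zx≈zy (⁻¹-cong X.z≉0 zx≈zy)) Y.tx≈t)
      wx≈wy : X.w ≈ Y.w
      wx≈wy = *-cancelʳ X.t≉0 (trans zx≈zy (*-congˡ (sym tx≈ty)))

    module Preimage {z : Carrier} (z∈μ* : InMu* z) where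
      T S x : Carrier
      T = z + z ⁻¹
      S = T ⁻¹
      x = z * S + θ

      z∈μ : InMu z
      z∈μ = proj₁ z∈μ*

      T≉0 : T ≉ 0#
      T≉0 = InMu*⇒z+z⁻¹≉0 z∈μ*

      T*S≈1 : T * S ≈ 1#
      T*S≈1 = inverseʳ T T≉0

      x∈Fq : InFq x
      x∈Fq = begin
        conj (z * S + θ)           ≈⟨ conj-+ (z * S) θ ⟩
        conj (z * S) + conj θ      ≈⟨ +-cong (conj-* z S) (conj-θ λ∈Fq θ∉Fq θ-root) ⟩
        conj z * conj S + (θ + 1#) ≈⟨ +-congʳ (*-cong (InMu⇒conj≈⁻¹ z∈μ) (InFq-⁻¹ T≉0 (InMu⇒z+z⁻¹∈Fq z∈μ))) ⟩
        z ⁻¹ * S + (θ + 1#)        ≈⟨ x≈y+c*[u+1]⇒x≈y T*S≈1 (solve 4 (λ z z⁻¹ S θ →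
                                        z⁻¹ :* S :+ (θ :+ :1) := (z :* S :+ θ) :+ :1 :* ((z :+ z⁻¹) :* S :+ :1))
                                        refl z (z ⁻¹) S θ) ⟩
        z * S + θ                  ∎

      private
        module X = Point x∈Fq

      wx≈zS : X.w ≈ z * S
      wx≈zS = x+y+y≈x (z * S) θ

      r≈S : X.r ≈ S
      r≈S = x*x≈y*y⇒x≈y (begin
        X.r * X.r                         ≈⟨ X.r*r≈w[w+1] ⟩
        X.w * (X.w + 1#)                  ≈⟨ *-cong wx≈zS (+-congʳ wx≈zS) ⟩
        (z * S) * (z * S + 1#)            ≈⟨ x≈y+c*[u+1]⇒x≈y T*S≈1 (solve 3 (λ z z⁻¹ S →
                                               (z :* S) :* (z :* S :+ :1)
                                                 := (S :* S :+ (S :* S) :* (z :* z⁻¹ :+ :1)) :+ (z :* S) :* ((z :+ z⁻¹) :* S :+ :1))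
                                               refl z (z ⁻¹) S) ⟩
        S * S + (S * S) * (z * z ⁻¹ + 1#) ≈⟨ x≈y+c*[u+1]⇒x≈y (inverseʳ z (InMu⇒≉0 z∈μ)) refl ⟩
        S * S                             ∎)

      zx≈z : zx λ' θ x ≈ z
      zx≈z = begin
        X.w * X.t     ≈⟨ *-cong wx≈zS (trans (⁻¹-cong X.r≉0 r≈S) (⁻¹-involutive T≉0)) ⟩
        (z * S) * T   ≈⟨ *-assoc z S T ⟩
        z * (S * T)   ≈⟨ *-congˡ (trans (*-comm S T) T*S≈1) ⟩
        z * 1#        ≈⟨ *-identityʳ z ⟩
        z             ∎

    zx-surjective : ∀ z → InMu* z → Σ Carrier λ x → InFq x × zx λ' θ x ≈ z
    zx-surjective z z∈μ* = x , x∈Fq , zx≈z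
      where open Preimage z∈μ*

open import Data.Nat using (_^_)

lemma2p3 : (e : ℕ) → NonZero e → 2 ∣ e →
    (F : FiniteField ((2 ^ e) ^ 2)) →
    let open Setup e F in
    (β : Carrier) → ¬ InFq β →
    (λ' : Carrier) → InFq λ' → Tr λ' ≈ 1# →
    (θ : Carrier) → ¬ InFq θ → ((((θ ^ᶠ 2) + θ) + λ') + 1#) ≈ 0# →
    (c : Carrier) → InFq c → β ≈ ((β + conj β) * (c + θ)) →
    (α : Carrier) → InFq α → ¬ (α ≈ 0#) →
    -- (a) x ↦ z_x is a bijection 𝔽_q → μ*_{q+1}
    ((∀ x → InFq x → InMu* (zx λ' θ x))
     × (∀ x y → InFq x → InFq y → zx λ' θ x ≈ zx λ' θ y → x ≈ y)
     × (∀ z → InMu* z → Σ Carrier (λ x → InFq x × (zx λ' θ x ≈ z))))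
    -- (b)
    × (∀ x → InFq x →
         (tx λ' θ x ≈ ((sqrt (A λ' x + 1#)) ⁻¹))
         × (sx λ' θ x ≈ (A λ' x * (((sqrt (A λ' x + 1#)) ⁻¹) ^ᶠ 3)))
         × ¬ (sx λ' θ x ≈ 0#))
    -- (c)
    × (∀ x → InFq x →
         (P α (zx λ' θ x) ≈ (α * ((sx λ' θ x ^ᶠ 3) + sx λ' θ x)))
         × (Q β (zx λ' θ x) ≈ (((β + conj β) * ((c + x) + 1#)) * sx λ' θ x)))
    -- (d)
    × (∀ x → InFq x → (1# + (((sx λ' θ x) ⁻¹) ^ᶠ 2)) ≈ Φ λ' x)
lemma2p3 e e≢0 _ F β _ λ' λ∈Fq Trλ≈1 θ θ∉Fq θ-root c _ β≈b[c+θ] α _ _ =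
  ((λ x x∈Fq → Point.z∈μ* x∈Fq) , zx-injective , zx-surjective) ,
  (λ x x∈Fq → let open Point x∈Fq in tx≈t , sx≈At³ , sx≉0) ,
  (λ x x∈Fq → let open Point x∈Fq in P[z]≈α[s³+s] α , Q[z]≈b[c+x+1]s β≈b[c+θ]) ,
  (λ x x∈Fq → Point.1+s⁻²≈Φ x∈Fq)
  where
  open SetupProperties e {{e≢0}} F
  open Construction λ∈Fq Trλ≈1 θ∉Fq θ-root
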